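{- Let $G$ be a simple graph with vertex set $\{x_1,\dots,x_n\}$, and write the vertices of $\mathcal{J}_s(G)$ as $x_{i,j}$ ($i=1,\dots,n$, $j=0,\dots,s$). Let $x_a, x_b$ be distinct vertices of $G$. For every $s\in\mathbb{N}$ and all $i,j\in\{0,\dots,s\}$, the set $\{x_{a,i},x_{b,j}\}$ is an edge of $\mathcal{J}_s(G)$ if and only if $\{x_a,x_b\}$ is an edge of $G$ and $i+j\leqslant s$.
   Context: Let $\Bbbk$ be a field and $R=\Bbbk[x_1,\dots,x_n]$. For $s\in\mathbb{N}$ let $\mathcal{J}_s(R)=\Bbbk[x_{i,j}\mid i=1,\dots,n,\ j=0,\dots,s]$. For an ideal $I=\langle f_1,\dots,f_r\rangle\subseteq R$, substitute $x_i\mapsto \sum_{j=0}^s x_{i,j}t^j$ in each $f_k$ and write the result as $\sum_{j\geqslant 0} f_{k,j}t^j$ with $f_{k,j}\in\mathcal{J}_s(R)$; the ideal of $s$-jets is $\mathcal{J}_s(I)=\langle f_{k,j}\mid k=1,\dots,r,\ j=0,\dots,s\rangle$. For a simple graph $G$ on $\{x_1,\dots,x_n\}$, the edge ideal is $I(G)=\langle x_ix_j\mid \{x_i,x_j\}\text{ an edge of }G\rangle$. The radical $\sqrt{\mathcal{J}_s(I(G))}$ is a squarefree monomial ideal generated in degree two; the $s$-jet graph $\mathcal{J}_s(G)$ is the simple graph on vertex set $\{x_{i,j}\}$ whose edges are the pairs $\{x_{i,j},x_{k,l}\}$ with $x_{i,j}x_{k,l}$ a minimal generator of $\sqrt{\mathcal{J}_s(I(G))}$.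 -}

module Defs where

open import Level using (Level; _⊔_)
open import Algebra.Bundles using (CommutativeRing)
open import Data.Nat as ℕ using (ℕ; zero; suc; _≤_)
open import Data.Fin using (Fin; toℕ; combine)
open import Data.Vec using (Vec; replicate; updateAt; zipWith; allFin)
open import Data.Vec.Relation.Binary.Pointwise.Inductive using (Pointwise)
import Data.Vec.Properties as VecP
open import Data.List using (List; []; _∷_; _++_; map; concatMap; foldr; upTo; filter)
open import Data.List.Relation.Unary.All using (All)
open import Data.Product using (Σ; ∃; ∃-syntax; _×_; _,_; proj₁; proj₂)
open import Relation.Binary.PropositionalEquality using (_≡_; _≢_)
open import Relation.Nullary using (¬_; yes; no)
open import Relation.Nullary.Decidable using (⌊_⌋)
open import Data.Bool using (Bool; true; false; if_then_else_)

record Field (c ℓ : Level) : Set (Level.suc (c ⊔ ℓ)) where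
  field
    commRing : CommutativeRing c ℓ
  open CommutativeRing commRing public
  field
    1≉0     : ¬ (1# ≈ 0#)
    inverse : ∀ x → ¬ (x ≈ 0#) → ∃[ y ] (x * y ≈ 1#)

record SimpleGraph (n : ℕ) : Set₁ where
  field
    Edge      : Fin n → Fin n → Set
    sym       : ∀ {u v} → Edge u v → Edge v u
    irreflex  : ∀ {u} → ¬ Edge u u

-- A monomial is an exponent vector; a polynomial is a finite list of
-- (coefficient , monomial) terms, with equality being equality of all
-- coefficients (so this is the polynomial ring K[y_0,…,y_{m-1}]).

Monomial : ℕ → Set
Monomial m = Vec ℕ m

module Poly {c ℓ} (K : Field c ℓ) where
  open Field K

  Pol : ℕ → Set c
  Pol m = List (Carrier × Monomial m)

  coeff : ∀ {m} → Pol m → Monomial m → Carrier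
  coeff []             e = 0#
  coeff ((a , e') ∷ p) e =
    (if ⌊ VecP.≡-dec ℕ._≟_ e' e ⌋ then a else 0#) + coeff p e

  _≃_ : ∀ {m} → Pol m → Pol m → Set ℓ
  p ≃ q = ∀ e → coeff p e ≈ coeff q e

  0P : ∀ {m} → Pol m
  0P = []

  1P : ∀ {m} → Pol m
  1P {m} = (1# , replicate m 0) ∷ []

  mono : ∀ {m} → Monomial m → Pol m
  mono e = (1# , e) ∷ []

  var : ∀ {m} → Fin m → Pol m
  var {m} k = mono (updateAt (replicate m 0) k (λ _ → 1))

  _+P_ : ∀ {m} → Pol m → Pol m → Pol m
  p +P q = p ++ q

  _*P_ : ∀ {m} → Pol m → Pol m → Pol m
  p *P q = concatMap (λ { (a , e) → map (λ { (b , f) → (a * b , zipWith ℕ._+_ e f) }) q }) p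

  _^P_ : ∀ {m} → Pol m → ℕ → Pol m
  p ^P zero  = 1P
  p ^P suc k = p *P (p ^P k)

  sumP : ∀ {m} → List (Pol m) → Pol m
  sumP = foldr _+P_ 0P

  _∈⟨_⟩ : ∀ {m} {ℓ'} → Pol m → (Pol m → Set ℓ') → Set (c ⊔ ℓ ⊔ ℓ')
  f ∈⟨ S ⟩ = ∃[ hs ] (All (λ hg → S (proj₂ hg)) hs
                     × f ≃ sumP (map (λ hg → proj₁ hg *P proj₂ hg) hs))

  _∈√⟨_⟩ : ∀ {m} {ℓ'} → Pol m → (Pol m → Set ℓ') → Set (c ⊔ ℓ ⊔ ℓ')
  f ∈√⟨ S ⟩ = ∃[ N ] ((f ^P N) ∈⟨ S ⟩)

  MinimalGenOfRadical : ∀ {m} {ℓ'} → (Pol m → Set ℓ') → Monomial m → Set (c ⊔ ℓ ⊔ ℓ')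
  MinimalGenOfRadical S e =
    mono e ∈√⟨ S ⟩ × (∀ e' → Pointwise _≤_ e' e → e' ≢ e → ¬ (mono e' ∈√⟨ S ⟩))

  -- Jets.  R = K[x_1..x_n] is Pol n;  J_s(R) = K[x_{i,j}] is
  -- Pol (n * suc s), the variable x_{i,j} being var (combine i j).

  JVars : ℕ → ℕ → ℕ
  JVars n s = n ℕ.* suc s

  jvar : ∀ {n} s → Fin n → Fin (suc s) → Pol (JVars n s)
  jvar s i j = var (combine i j)

  -- power series in t with coefficients in J_s(R): j ↦ coefficient of t^j
  record Series (n s : ℕ) : Set c where
    constructor ser
    field at : ℕ → Pol (JVars n s)
  open Series public

  subst : ∀ {n} s → Fin n → Series n s
  subst {n} s i = ser go
    where
    go : ℕ → Pol (JVars n s)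
    go j with j ℕ.<? suc s
    ... | yes j<  = jvar s i (Data.Fin.fromℕ< j<)
    ... | no  _   = 0P

  _*S_ : ∀ {n s} → Series n s → Series n s → Series n s
  F *S G = ser (λ j → sumP (map (λ p → at F p *P at G (j ℕ.∸ p)) (upTo (suc j))))

  constS : ∀ {n s} → Carrier → Series n s
  constS {n} {s} a = ser go
    where
    go : ℕ → Pol (JVars n s)
    go zero    = (a , replicate (JVars n s) 0) ∷ []
    go (suc _) = 0P

  _+S_ : ∀ {n s} → Series n s → Series n s → Series n s
  F +S G = ser (λ j → at F j +P at G j)

  0S : ∀ {n s} → Series n s
  0S = ser (λ _ → 0P)

  powS : ∀ {n s} → Series n s → ℕ → Series n s
  powS F zero    = constS 1#
  powS F (suc k) = F *S powS F k

  substMono : ∀ {n} s → Monomial n → Series n s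
  substMono {n} s e =
    foldr (λ { (i , k) acc → powS (subst s i) k *S acc }) (constS 1#)
          (Data.Vec.toList (Data.Vec.zip (allFin n) e))

  substPol : ∀ {n} s → Pol n → Series n s
  substPol s []            = 0S
  substPol s ((a , e) ∷ f) = (constS a *S substMono s e) +S substPol s f

  JetGens : ∀ {n ℓ'} s → (Pol n → Set ℓ') → Pol (JVars n s) → Set (c ⊔ ℓ')
  JetGens s S g = ∃[ f ] (S f × ∃[ j ] (j ≤ s × g ≡ at (substPol s f) j))

  EdgeGens : ∀ {n} → SimpleGraph n → Pol n → Set c
  EdgeGens G f = ∃[ a ] ∃[ b ] (SimpleGraph.Edge G a b × f ≡ var a *P var b)

  jmono2 : ∀ {n} s → Fin n × Fin (suc s) → Fin n × Fin (suc s) → Monomial (JVars n s)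
  jmono2 {n} s (i , j) (k , l) =
    updateAt (updateAt (replicate (JVars n s) 0) (combine i j) suc) (combine k l) suc

  JetEdge : ∀ {n} (G : SimpleGraph n) s → Fin n × Fin (suc s) → Fin n × Fin (suc s) → Set (c ⊔ ℓ)
  JetEdge G s u v = u ≢ v × MinimalGenOfRadical (JetGens s (EdgeGens G)) (jmono2 s u v)

-- For an edge {x_a, x_b} the s-jet generators are the convolutions
-- f_l = Σ_{p+q=l} x_{a,p} x_{b,q}, l ≤ s.  By induction on the weight l,
-- each term m = x_{a,i} x_{b,l-i} lies in the radical: in m·f_l every
-- other product m·x_{a,p} x_{b,l-p} is a multiple of a term of smaller
-- weight, so m² and hence m are in the radical.  Conversely, set all
-- variables except x_{a,i}, x_{b,j} to zero.  A generator survives only if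
-- one of its terms is x_{a,i} x_{b,j}, which forces {x_a, x_b} to be an
-- edge and i + j ≤ s; otherwise the whole jet ideal dies while no power of
-- a monomial in x_{a,i}, x_{b,j} does.  Keeping a single variable instead
-- kills every generator, which gives minimality.

module Submission where

open import Defs
open import Level using (_⊔_)
open import Algebra.Bundles using (CommutativeRing)
open import Data.Bool using (true; false; if_then_else_)
open import Data.Empty using (⊥-elim)
open import Data.Fin using (Fin; zero; suc; toℕ; fromℕ<; combine)
import Data.Fin.Properties as Finₚ
open import Data.List using (List; []; _∷_; _++_; map; concatMap; foldr; applyUpTo)
import Data.List.Properties as Listₚ
open import Data.List.Relation.Unary.All using (All; []; _∷_)
import Data.List.Relation.Unary.All.Properties as Allₚ
open import Data.Nat as ℕ using (ℕ; zero; suc; _∸_; _≤_; _<_)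
import Data.Nat.Properties as ℕₚ
open import Data.Nat.Induction using (<-rec)
open import Data.Product using (_×_; _,_; proj₁; proj₂; ∃-syntax)
open import Data.Sum as Sum using (_⊎_; inj₁; inj₂)
open import Data.Vec using (Vec; []; _∷_; zipWith; replicate; updateAt; lookup; tabulate; toList; zip)
open import Data.Vec.Properties
  using (≡-dec; zipWith-comm; zipWith-assoc; zipWith-identityˡ; zipWith-identityʳ; lookup-zipWith;
         lookup-replicate; lookup∘updateAt; lookup∘updateAt′; tabulate∘lookup; tabulate-cong)
open import Data.Vec.Relation.Binary.Pointwise.Inductive as Pointwise using (Pointwise; []; _∷_)
open import Function using (_∘_; id)
open import Function.Bundles using (_⇔_; mk⇔)
open import Relation.Binary.Definitions using (tri<; tri≈; tri>)
open import Relation.Binary.PropositionalEquality as ≡ using (_≡_; _≢_)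
open import Relation.Nullary using (¬_; Dec; yes; no; contradiction; _×-dec_; _⊎-dec_)
open import Relation.Nullary.Decidable using (⌊_⌋)

infixl 6 _⊕_ _⊖_

_⊕_ : ∀ {m} → Monomial m → Monomial m → Monomial m
_⊕_ = zipWith ℕ._+_

_⊖_ : ∀ {m} → Monomial m → Monomial m → Monomial m
_⊖_ = zipWith _∸_

_≼_ : ∀ {m} → Monomial m → Monomial m → Set
_≼_ = Pointwise _≤_

_≼?_ : ∀ {m} (d e : Monomial m) → Dec (d ≼ e)
_≼?_ = Pointwise.decidable ℕₚ._≤?_

unitExp : ∀ {m} → Fin m → Monomial m
unitExp {m} k = updateAt (replicate m 0) k (λ _ → 1)

-- The exponent vector of y_u y_w, written as in jmono2.
pairExp : ∀ {m} → Fin m → Fin m → Monomial m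
pairExp {m} u w = updateAt (updateAt (replicate m 0) u suc) w suc

scaleExp : ∀ {m} → ℕ → Monomial m → Monomial m
scaleExp {m} zero    e = replicate m 0
scaleExp     (suc N) e = e ⊕ scaleExp N e

lookup-ext : ∀ {m} {d e : Monomial m} → (∀ k → lookup d k ≡ lookup e k) → d ≡ e
lookup-ext {d = d} {e} d≗e =
  ≡.trans (≡.sym (tabulate∘lookup d)) (≡.trans (tabulate-cong d≗e) (tabulate∘lookup e))

lookup-⊕ : ∀ {m} (d f : Monomial m) k → lookup (d ⊕ f) k ≡ lookup d k ℕ.+ lookup f k
lookup-⊕ d f k = lookup-zipWith ℕ._+_ k d f

⊕-comm : ∀ {m} (d f : Monomial m) → d ⊕ f ≡ f ⊕ d
⊕-comm = zipWith-comm ℕₚ.+-comm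

⊕-assoc : ∀ {m} (d f g : Monomial m) → (d ⊕ f) ⊕ g ≡ d ⊕ (f ⊕ g)
⊕-assoc = zipWith-assoc ℕₚ.+-assoc

⊕-identityˡ : ∀ {m} (f : Monomial m) → replicate m 0 ⊕ f ≡ f
⊕-identityˡ = zipWith-identityˡ ℕₚ.+-identityˡ

⊕-identityʳ : ∀ {m} (f : Monomial m) → f ⊕ replicate m 0 ≡ f
⊕-identityʳ = zipWith-identityʳ ℕₚ.+-identityʳ

⊕≡⇒≼ : ∀ {m} (d f : Monomial m) {e} → d ⊕ f ≡ e → d ≼ e
⊕≡⇒≼ []      []      ≡.refl = []
⊕≡⇒≼ (x ∷ d) (y ∷ f) ≡.refl = ℕₚ.m≤m+n x y ∷ ⊕≡⇒≼ d f ≡.refl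

⊕≡⇒≡⊖ : ∀ {m} (d f : Monomial m) {e} → d ⊕ f ≡ e → f ≡ e ⊖ d
⊕≡⇒≡⊖ []      []      ≡.refl = ≡.refl
⊕≡⇒≡⊖ (x ∷ d) (y ∷ f) ≡.refl = ≡.cong₂ _∷_ (≡.sym (ℕₚ.m+n∸m≡n x y)) (⊕≡⇒≡⊖ d f ≡.refl)

⊕-⊖-cancel : ∀ {m} {d e : Monomial m} → d ≼ e → d ⊕ (e ⊖ d) ≡ e
⊕-⊖-cancel []          = ≡.refl
⊕-⊖-cancel (x≤y ∷ d≼e) = ≡.cong₂ _∷_ (ℕₚ.m+[n∸m]≡n x≤y) (⊕-⊖-cancel d≼e)

updateAt-suc≡unitExp⊕ : ∀ {m} (k : Fin m) (v : Monomial m) → updateAt v k suc ≡ unitExp k ⊕ v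
updateAt-suc≡unitExp⊕ zero    (x ∷ v) = ≡.cong (suc x ∷_) (≡.sym (⊕-identityˡ v))
updateAt-suc≡unitExp⊕ (suc k) (x ∷ v) = ≡.cong (x ∷_) (updateAt-suc≡unitExp⊕ k v)

pairExp≡unitExp⊕unitExp : ∀ {m} (u w : Fin m) → pairExp u w ≡ unitExp u ⊕ unitExp w
pairExp≡unitExp⊕unitExp {m} u w = begin
  updateAt (updateAt (replicate m 0) u suc) w suc  ≡⟨ updateAt-suc≡unitExp⊕ w _ ⟩
  unitExp w ⊕ updateAt (replicate m 0) u suc       ≡⟨ ≡.cong (unitExp w ⊕_) (updateAt-suc≡unitExp⊕ u _) ⟩
  unitExp w ⊕ (unitExp u ⊕ replicate m 0)          ≡⟨ ≡.cong (unitExp w ⊕_) (⊕-identityʳ (unitExp u)) ⟩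
  unitExp w ⊕ unitExp u                            ≡⟨ ⊕-comm (unitExp w) (unitExp u) ⟩
  unitExp u ⊕ unitExp w                            ∎
  where open ≡.≡-Reasoning

lookup-unitExp : ∀ {m} (k : Fin m) → lookup (unitExp k) k ≡ 1
lookup-unitExp {m} k = lookup∘updateAt k (replicate m 0)

lookup-unitExp-≢ : ∀ {m} {j k : Fin m} → j ≢ k → lookup (unitExp k) j ≡ 0
lookup-unitExp-≢ {m} {j} {k} j≢k =
  ≡.trans (lookup∘updateAt′ j k j≢k (replicate m 0)) (lookup-replicate j 0)

SupportedOn : ∀ {m} → Fin m → Fin m → Monomial m → Set
SupportedOn u w e = ∀ k → k ≢ u → k ≢ w → lookup e k ≡ 0

SupportedOn-⊖ : ∀ {m} {u w : Fin m} {e} d → SupportedOn u w e → SupportedOn u w (e ⊖ d)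
SupportedOn-⊖ {e = e} d supp k k≢u k≢w =
  ≡.trans (lookup-zipWith _∸_ k e d) (≡.trans (≡.cong (_∸ lookup d k) (supp k k≢u k≢w)) (ℕₚ.0∸n≡0 (lookup d k)))

SupportedOn-scaleExp : ∀ {m} {u w : Fin m} {e} N → SupportedOn u w e → SupportedOn u w (scaleExp N e)
SupportedOn-scaleExp         zero    supp k _   _   = lookup-replicate k 0
SupportedOn-scaleExp {e = e} (suc N) supp k k≢u k≢w =
  ≡.trans (lookup-⊕ e (scaleExp N e) k) (≡.cong₂ ℕ._+_ (supp k k≢u k≢w) (SupportedOn-scaleExp N supp k k≢u k≢w))

SupportedOn-unitExp⊕ : ∀ {m} {u w : Fin m} k f → SupportedOn u w (unitExp k ⊕ f) → k ≡ u ⊎ k ≡ w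
SupportedOn-unitExp⊕ {u = u} {w} k f supp with k Finₚ.≟ u | k Finₚ.≟ w
... | yes k≡u | _       = inj₁ k≡u
... | no  _   | yes k≡w = inj₂ k≡w
... | no  k≢u | no  k≢w = contradiction (≡.trans (≡.sym (lookup-⊕ (unitExp k) f k)) (supp k k≢u k≢w)) nonzero
  where
  nonzero : lookup (unitExp k) k ℕ.+ lookup f k ≢ 0
  nonzero rewrite lookup-unitExp k = λ ()

SupportedOn-≼ : ∀ {m} {u w : Fin m} {d e} → d ≼ e → SupportedOn u w e → SupportedOn u w d
SupportedOn-≼ d≼e supp k k≢u k≢w = ℕₚ.n≤0⇒n≡0 (≡.subst (_ ≤_) (supp k k≢u k≢w) (Pointwise.lookup d≼e k))

SupportedOn-drop : ∀ {m} {u w : Fin m} {e} → SupportedOn u w e → lookup e w ≡ 0 → SupportedOn u u e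
SupportedOn-drop {w = w} supp e[w]≡0 k k≢u _ with k Finₚ.≟ w
... | yes ≡.refl = e[w]≡0
... | no  k≢w    = supp k k≢u k≢w

pairExp-supported : ∀ {m} (u w : Fin m) → SupportedOn u w (pairExp u w)
pairExp-supported u w k k≢u k≢w rewrite pairExp≡unitExp⊕unitExp u w | lookup-⊕ (unitExp u) (unitExp w) k
  = ≡.cong₂ ℕ._+_ (lookup-unitExp-≢ k≢u) (lookup-unitExp-≢ k≢w)

lookup-pairExpˡ : ∀ {m} {u w : Fin m} → u ≢ w → lookup (pairExp u w) u ≡ 1
lookup-pairExpˡ {u = u} {w} u≢w rewrite pairExp≡unitExp⊕unitExp u w | lookup-⊕ (unitExp u) (unitExp w) u
  = ≡.cong₂ ℕ._+_ (lookup-unitExp u) (lookup-unitExp-≢ u≢w)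

lookup-pairExpʳ : ∀ {m} {u w : Fin m} → u ≢ w → lookup (pairExp u w) w ≡ 1
lookup-pairExpʳ {u = u} {w} u≢w rewrite pairExp≡unitExp⊕unitExp u w | lookup-⊕ (unitExp u) (unitExp w) w
  = ≡.cong₂ ℕ._+_ (lookup-unitExp-≢ (u≢w ∘ ≡.sym)) (lookup-unitExp w)

≼-pairExp : ∀ {m} {u w : Fin m} {e} → u ≢ w → e ≼ pairExp u w →
            SupportedOn u u e ⊎ SupportedOn w w e ⊎ e ≡ pairExp u w
≼-pairExp {u = u} {w} {e} u≢w e≼ with lookup e w ℕ.≟ 0 | lookup e u ℕ.≟ 0
... | yes e[w]≡0 | _          = inj₁ (SupportedOn-drop {e = e} supp e[w]≡0)
  where
  supp : SupportedOn u w e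
  supp = SupportedOn-≼ e≼ (pairExp-supported u w)
... | no  _      | yes e[u]≡0 = inj₂ (inj₁ (SupportedOn-drop {e = e} supp e[u]≡0))
  where
  supp : SupportedOn w u e
  supp k k≢w k≢u = SupportedOn-≼ e≼ (pairExp-supported u w) k k≢u k≢w
... | no  e[w]≢0 | no  e[u]≢0 = inj₂ (inj₂ (lookup-ext pointwise))
  where
  one : ∀ {k} → lookup e k ≢ 0 → lookup (pairExp u w) k ≡ 1 → lookup e k ≡ lookup (pairExp u w) k
  one {k} e[k]≢0 p[k]≡1 = ≡.trans
    (ℕₚ.≤-antisym (≡.subst (_ ≤_) p[k]≡1 (Pointwise.lookup e≼ k)) (ℕₚ.n≢0⇒n>0 e[k]≢0)) (≡.sym p[k]≡1)
  pointwise : ∀ k → lookup e k ≡ lookup (pairExp u w) k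
  pointwise k with k Finₚ.≟ u | k Finₚ.≟ w
  ... | yes ≡.refl | _          = one e[u]≢0 (lookup-pairExpˡ u≢w)
  ... | no  _      | yes ≡.refl = one e[w]≢0 (lookup-pairExpʳ u≢w)
  ... | no  k≢u    | no  k≢w    = ≡.trans (SupportedOn-≼ e≼ (pairExp-supported u w) k k≢u k≢w)
                                          (≡.sym (pairExp-supported u w k k≢u k≢w))

m<n≤o⇒m+[o∸n]<o : ∀ {m n o} → m < n → n ≤ o → m ℕ.+ (o ∸ n) < o
m<n≤o⇒m+[o∸n]<o {m} {n} {o} m<n n≤o =
  ≡.subst (m ℕ.+ (o ∸ n) <_) (ℕₚ.m+[n∸m]≡n n≤o) (ℕₚ.+-monoˡ-< (o ∸ n) m<n)

module Sums {r ℓr} (R : CommutativeRing r ℓr) where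
  open CommutativeRing R

  Σ< : ℕ → (ℕ → Carrier) → Carrier
  Σ< zero    T = 0#
  Σ< (suc k) T = Σ< k T + T k

  convolution : (ℕ → Carrier) → (ℕ → Carrier) → ℕ → Carrier
  convolution X Y l = Σ< (suc l) (λ p → X p * Y (l ∸ p))

  Σ<-cong : ∀ k {S T} → (∀ p → S p ≈ T p) → Σ< k S ≈ Σ< k T
  Σ<-cong zero    S≈T = refl
  Σ<-cong (suc k) S≈T = +-cong (Σ<-cong k S≈T) (S≈T k)

  Σ<-*ˡ : ∀ k z T → Σ< k (λ p → z * T p) ≈ z * Σ< k T
  Σ<-*ˡ zero    z T = sym (zeroʳ z)
  Σ<-*ˡ (suc k) z T = trans (+-congʳ (Σ<-*ˡ k z T)) (sym (distribˡ z _ _))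

  Σ<-head : ∀ k T → Σ< (suc k) T ≈ T 0 + Σ< k (λ p → T (suc p))
  Σ<-head zero    T = trans (+-identityˡ _) (sym (+-identityʳ _))
  Σ<-head (suc k) T = trans (+-congʳ (Σ<-head k T)) (+-assoc _ _ _)

  Σ<-zero : ∀ k T → (∀ p → p < k → T p ≈ 0#) → Σ< k T ≈ 0#
  Σ<-zero zero    T T≈0 = refl
  Σ<-zero (suc k) T T≈0 =
    trans (+-cong (Σ<-zero k T (λ p p<k → T≈0 p (ℕₚ.m<n⇒m<1+n p<k))) (T≈0 k ℕₚ.≤-refl)) (+-identityˡ _)

module Ideals {r ℓr} (R : CommutativeRing r ℓr) where
  open CommutativeRing R
  open Sums R
  open import Algebra.Properties.CommutativeSemiring.Exp commutativeSemiring
    using (_^_; ^-congˡ; ^-homo-*; ^-distrib-*)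
  open import Algebra.Properties.CommutativeSemigroup *-commutativeSemigroup
    using (interchange; x∙yz≈y∙xz)
  open import Algebra.Properties.Ring ring using (-1*x≈-x)
  open import Algebra.Properties.Group +-group using (\\-leftDividesʳ)
  open import Relation.Binary.Reasoning.Setoid setoid

  record IsIdeal {ι} (I : Carrier → Set ι) : Set (r ⊔ ℓr ⊔ ι) where
    field
      ∈-resp-≈  : ∀ {x y} → x ≈ y → I x → I y
      0#∈       : I 0#
      +-closed  : ∀ {x y} → I x → I y → I (x + y)
      *-closedˡ : ∀ z {x} → I x → I (z * x)

    *-closedʳ : ∀ z {x} → I x → I (x * z)
    *-closedʳ z x∈ = ∈-resp-≈ (*-comm z _) (*-closedˡ z x∈)

    +-cancelˡ : ∀ {x y} → I (x + y) → I x → I y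
    +-cancelˡ {x} {y} x+y∈ x∈ =
      ∈-resp-≈ (\\-leftDividesʳ x y)
        (+-closed (∈-resp-≈ (-1*x≈-x x) (*-closedˡ (- 1#) x∈)) x+y∈)

    +-cancelʳ : ∀ {x y} → I (x + y) → I y → I x
    +-cancelʳ x+y∈ = +-cancelˡ (∈-resp-≈ (+-comm _ _) x+y∈)
  open IsIdeal public

  ⊎-isIdeal : ∀ {ι a} {I : Carrier → Set ι} (A : Set a) → IsIdeal I → IsIdeal (λ x → A ⊎ I x)
  ⊎-isIdeal A isI = record
    { ∈-resp-≈  = λ x≈y → Sum.map₂ (∈-resp-≈ isI x≈y)
    ; 0#∈       = inj₂ (0#∈ isI)
    ; +-closed  = λ { (inj₁ a) _ → inj₁ a ; (inj₂ _) (inj₁ a) → inj₁ a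
                    ; (inj₂ x∈) (inj₂ y∈) → inj₂ (+-closed isI x∈ y∈) }
    ; *-closedˡ = λ z → Sum.map₂ (*-closedˡ isI z)
    }

  _∶_ : ∀ {ι} → (Carrier → Set ι) → Carrier → Carrier → Set ι
  (I ∶ x) y = I (x * y)

  ∶-isIdeal : ∀ {ι} {I : Carrier → Set ι} → IsIdeal I → ∀ x → IsIdeal (I ∶ x)
  ∶-isIdeal isI x = record
    { ∈-resp-≈  = λ y≈z → ∈-resp-≈ isI (*-congˡ y≈z)
    ; 0#∈       = ∈-resp-≈ isI (sym (zeroʳ x)) (0#∈ isI)
    ; +-closed  = λ y∈ z∈ → ∈-resp-≈ isI (sym (distribˡ x _ _)) (+-closed isI y∈ z∈)
    ; *-closedˡ = λ z {y} y∈ → ∈-resp-≈ isI (x∙yz≈y∙xz z x y) (*-closedˡ isI z y∈)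
    }

  -- The binomial theorem in disguise: split (x + y)^(m+n) as x·(x + y)^(m+n-1) + y·(x + y)^(m+n-1)
  -- and recurse in the ideals I ∶ x and I ∶ y.
  ^-+-closed : ∀ {ι} {I : Carrier → Set ι} → IsIdeal I → ∀ m n {x y} →
               I (x ^ m) → I (y ^ n) → I ((x + y) ^ (m ℕ.+ n))
  ^-+-closed isI zero    n       {x} {y} x^m∈ y^n∈ =
    ∈-resp-≈ isI (*-identityʳ _) (*-closedˡ isI ((x + y) ^ n) x^m∈)
  ^-+-closed isI (suc m) zero    {x} {y} x^m∈ y^n∈ =
    ∈-resp-≈ isI (*-identityʳ _) (*-closedˡ isI ((x + y) ^ suc (m ℕ.+ 0)) y^n∈)
  ^-+-closed {I = I} isI (suc m) (suc n) {x} {y} x^m∈ y^n∈ =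
    ∈-resp-≈ isI (sym (distribʳ _ x y)) (+-closed isI x-part y-part)
    where
    x-part : I (x * (x + y) ^ (m ℕ.+ suc n))
    x-part = ^-+-closed (∶-isIdeal isI x) m (suc n) x^m∈ (*-closedˡ isI x y^n∈)
    y-part : I (y * (x + y) ^ (m ℕ.+ suc n))
    y-part = ≡.subst (λ k → I (y * (x + y) ^ k)) (≡.sym (ℕₚ.+-suc m n))
               (^-+-closed (∶-isIdeal isI y) (suc m) n (*-closedˡ isI y x^m∈) y^n∈)

  √ : ∀ {ι} → (Carrier → Set ι) → Carrier → Set ι
  √ I x = ∃[ N ] I (x ^ N)

  √-isIdeal : ∀ {ι} {I : Carrier → Set ι} → IsIdeal I → IsIdeal (√ I)
  √-isIdeal isI = record
    { ∈-resp-≈  = λ { x≈y (N , x^N∈) → N , ∈-resp-≈ isI (^-congˡ N x≈y) x^N∈ }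
    ; 0#∈       = 1 , ∈-resp-≈ isI (sym (zeroˡ _)) (0#∈ isI)
    ; +-closed  = λ { (N , x^N∈) (M , y^M∈) → N ℕ.+ M , ^-+-closed isI N M x^N∈ y^M∈ }
    ; *-closedˡ = λ { z {x} (N , x^N∈) →
                      N , ∈-resp-≈ isI (sym (^-distrib-* z x N)) (*-closedˡ isI (z ^ N) x^N∈) }
    }

  ⊆√ : ∀ {ι} {I : Carrier → Set ι} → IsIdeal I → ∀ {x} → I x → √ I x
  ⊆√ isI x∈ = 1 , ∈-resp-≈ isI (sym (*-identityʳ _)) x∈

  √-square : ∀ {ι} {I : Carrier → Set ι} → IsIdeal I → ∀ {x} → √ I (x * x) → √ I x
  √-square isI {x} (N , xx^N∈) =
    N ℕ.+ N , ∈-resp-≈ isI (trans (^-distrib-* x x N) (sym (^-homo-* x N N))) xx^N∈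

  module _ {ι} {I : Carrier → Set ι} (isI : IsIdeal I) where

    Σ<-closed : ∀ k T → (∀ p → p < k → I (T p)) → I (Σ< k T)
    Σ<-closed zero    T T∈ = 0#∈ isI
    Σ<-closed (suc k) T T∈ =
      +-closed isI (Σ<-closed k T (λ p p<k → T∈ p (ℕₚ.m<n⇒m<1+n p<k))) (T∈ k ℕₚ.≤-refl)

    Σ<-remaining-term : ∀ k T {i} → i < k → I (Σ< k T) →
                        (∀ p → p < k → p ≢ i → I (T p)) → I (T i)
    Σ<-remaining-term (suc k) T {i} i<1+k Σ∈ T∈ with i ℕ.≟ k
    ... | yes ≡.refl = +-cancelˡ isI Σ∈ (Σ<-closed k T (λ p p<k → T∈ p (ℕₚ.m<n⇒m<1+n p<k) (ℕₚ.<⇒≢ p<k)))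
    ... | no  i≢k    = Σ<-remaining-term k T (ℕₚ.≤∧≢⇒< (ℕₚ.≤-pred i<1+k) i≢k)
                         (+-cancelʳ isI Σ∈ (T∈ k ℕₚ.≤-refl (λ k≡i → i≢k (≡.sym k≡i))))
                         (λ p p<k → T∈ p (ℕₚ.m<n⇒m<1+n p<k))

  ab∙cd≈cb∙ad : ∀ a b c d → (a * b) * (c * d) ≈ (c * b) * (a * d)
  ab∙cd≈cb∙ad a b c d = begin
    (a * b) * (c * d) ≈⟨ interchange a b c d ⟩
    (a * c) * (b * d) ≈⟨ *-congʳ (*-comm a c) ⟩
    (c * a) * (b * d) ≈⟨ interchange c a b d ⟩
    (c * b) * (a * d) ∎

  ab∙cd≈ad∙cb : ∀ a b c d → (a * b) * (c * d) ≈ (a * d) * (c * b)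
  ab∙cd≈ad∙cb a b c d = begin
    (a * b) * (c * d) ≈⟨ *-congˡ (*-comm c d) ⟩
    (a * b) * (d * c) ≈⟨ interchange a b d c ⟩
    (a * d) * (b * c) ≈⟨ *-congˡ (*-comm b c) ⟩
    (a * d) * (c * b) ∎

  module Convolution {ι} {I : Carrier → Set ι} (isI : IsIdeal I) (X Y : ℕ → Carrier) where

    private
      √isI : IsIdeal (√ I)
      √isI = √-isIdeal isI

    -- Multiplying convolution X Y l by its term m = X i Y (l ∸ i), every other product
    -- m · X p Y (l ∸ p) is a multiple of a term of weight < l.
    term∈√ : ∀ l → I (convolution X Y l) → (∀ p q → p ℕ.+ q < l → √ I (X p * Y q)) →
             ∀ i → i ≤ l → √ I (X i * Y (l ∸ i))
    term∈√ l conv∈ lower i i≤l =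
      √-square isI (Σ<-remaining-term √isI (suc l) T (ℕ.s≤s i≤l) Σ∈ other∈)
      where
      m : Carrier
      m = X i * Y (l ∸ i)
      T : ℕ → Carrier
      T p = m * (X p * Y (l ∸ p))
      Σ∈ : √ I (Σ< (suc l) T)
      Σ∈ = ⊆√ isI (∈-resp-≈ isI (sym (Σ<-*ˡ (suc l) m _)) (*-closedˡ isI m conv∈))
      other∈ : ∀ p → p < suc l → p ≢ i → √ I (T p)
      other∈ p p<1+l p≢i with ℕₚ.<-cmp p i
      ... | tri< p<i _ _ = ∈-resp-≈ √isI (sym (ab∙cd≈cb∙ad _ _ _ _))
                             (*-closedʳ √isI _ (lower p (l ∸ i) (m<n≤o⇒m+[o∸n]<o p<i i≤l)))
      ... | tri≈ _ p≡i _ = contradiction p≡i p≢i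
      ... | tri> _ _ i<p = ∈-resp-≈ √isI (sym (ab∙cd≈ad∙cb _ _ _ _))
                             (*-closedʳ √isI _ (lower i (l ∸ p) (m<n≤o⇒m+[o∸n]<o i<p (ℕₚ.≤-pred p<1+l))))

    terms∈√ : ∀ s → (∀ l → l ≤ s → I (convolution X Y l)) → ∀ p q → p ℕ.+ q ≤ s → √ I (X p * Y q)
    terms∈√ s conv∈ p q = <-rec P step (p ℕ.+ q) p q ≡.refl
      where
      P : ℕ → Set ι
      P l = ∀ p q → p ℕ.+ q ≡ l → l ≤ s → √ I (X p * Y q)
      step : ∀ l → (∀ {l′} → l′ < l → P l′) → P l
      step l rec p q ≡.refl l≤s =
        ≡.subst (λ k → √ I (X p * Y k)) (ℕₚ.m+n∸m≡n p q)
          (term∈√ l (conv∈ l l≤s) lower p (ℕₚ.m≤m+n p q))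
        where
        lower : ∀ p′ q′ → p′ ℕ.+ q′ < l → √ I (X p′ * Y q′)
        lower p′ q′ w<l = rec w<l p′ q′ ≡.refl (ℕₚ.<⇒≤ (ℕₚ.<-≤-trans w<l l≤s))

module PolynomialRing {c ℓ} (K : Field c ℓ) where
  open Field K
  open Poly K
  open import Algebra.Properties.Ring ring using (-0#≈0#; -‿+-comm)
  open import Algebra.Properties.CommutativeSemigroup +-commutativeSemigroup using (x∙yz≈y∙xz)
  open import Relation.Binary.Reasoning.Setoid setoid

  ∑ : ∀ {a} {A : Set a} → List A → (A → Carrier) → Carrier
  ∑ []       F = 0#
  ∑ (x ∷ xs) F = F x + ∑ xs F

  module _ {a} {A : Set a} where

    ∑-cong : ∀ (xs : List A) {F G} → (∀ x → F x ≈ G x) → ∑ xs F ≈ ∑ xs G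
    ∑-cong []       F≈G = refl
    ∑-cong (x ∷ xs) F≈G = +-cong (F≈G x) (∑-cong xs F≈G)

    ∑-++ : ∀ (xs ys : List A) F → ∑ (xs ++ ys) F ≈ ∑ xs F + ∑ ys F
    ∑-++ []       ys F = sym (+-identityˡ _)
    ∑-++ (x ∷ xs) ys F = trans (+-congˡ (∑-++ xs ys F)) (sym (+-assoc _ _ _))

    ∑-+ : ∀ (xs : List A) F G → ∑ xs (λ x → F x + G x) ≈ ∑ xs F + ∑ xs G
    ∑-+ []       F G = sym (+-identityˡ _)
    ∑-+ (x ∷ xs) F G = begin
      (F x + G x) + ∑ xs (λ x → F x + G x) ≈⟨ +-congˡ (∑-+ xs F G) ⟩
      (F x + G x) + (∑ xs F + ∑ xs G)      ≈⟨ +-assoc _ _ _ ⟩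
      F x + (G x + (∑ xs F + ∑ xs G))      ≈⟨ +-congˡ (x∙yz≈y∙xz (G x) _ _) ⟩
      F x + (∑ xs F + (G x + ∑ xs G))      ≈⟨ sym (+-assoc _ _ _) ⟩
      (F x + ∑ xs F) + (G x + ∑ xs G)      ∎

    ∑-zero : ∀ (xs : List A) F → (∀ x → F x ≈ 0#) → ∑ xs F ≈ 0#
    ∑-zero []       F F≈0 = refl
    ∑-zero (x ∷ xs) F F≈0 = trans (+-cong (F≈0 x) (∑-zero xs F F≈0)) (+-identityˡ _)

  ∑-swap : ∀ {a b} {A : Set a} {B : Set b} (xs : List A) (ys : List B) (F : A → B → Carrier) →
           ∑ xs (λ x → ∑ ys (F x)) ≈ ∑ ys (λ y → ∑ xs (λ x → F x y))
  ∑-swap []       ys F = sym (∑-zero ys _ (λ _ → refl))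
  ∑-swap (x ∷ xs) ys F = trans (+-congˡ (∑-swap xs ys F)) (sym (∑-+ ys _ _))

  ∑-concatMap : ∀ {a b} {A : Set a} {B : Set b} (g : A → List B) (xs : List A) F →
                ∑ (concatMap g xs) F ≈ ∑ xs (λ x → ∑ (g x) F)
  ∑-concatMap g []       F = refl
  ∑-concatMap g (x ∷ xs) F = trans (∑-++ (g x) (concatMap g xs) F) (+-congˡ (∑-concatMap g xs F))

  ∑-map : ∀ {a b} {A : Set a} {B : Set b} (g : A → B) (xs : List A) F →
          ∑ (map g xs) F ≡ ∑ xs (λ x → F (g x))
  ∑-map g []       F = ≡.refl
  ∑-map g (x ∷ xs) F = ≡.cong (F (g x) +_) (∑-map g xs F)

  Term : ℕ → Set c
  Term m = Carrier × Monomial m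

  termCoeff : ∀ {m} → Monomial m → Term m → Carrier
  termCoeff e (a , d) = if ⌊ ≡-dec ℕ._≟_ d e ⌋ then a else 0#

  _·_ : ∀ {m} → Term m → Term m → Term m
  (a , d) · (b , f) = a * b , d ⊕ f

  coeff≡∑ : ∀ {m} (p : Pol m) e → coeff p e ≡ ∑ p (termCoeff e)
  coeff≡∑ []       e = ≡.refl
  coeff≡∑ (t ∷ p)  e = ≡.cong (termCoeff e t +_) (coeff≡∑ p e)

  ∑-*P : ∀ {m} (p q : Pol m) (F : Term m → Carrier) → ∑ (p *P q) F ≈ ∑ p (λ t → ∑ q (λ u → F (t · u)))
  ∑-*P p q F = begin
    ∑ (p *P q) F                      ≈⟨ ∑-concatMap _ p F ⟩
    ∑ p (λ t → ∑ (map _ q) F)         ≈⟨ ∑-cong p (λ t → reflexive (∑-map _ q F)) ⟩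
    ∑ p (λ t → ∑ q (λ u → F (t · u))) ∎

  coeff-++ : ∀ {m} (p q : Pol m) e → coeff (p ++ q) e ≈ coeff p e + coeff q e
  coeff-++ p q e = begin
    coeff (p ++ q) e              ≡⟨ coeff≡∑ (p ++ q) e ⟩
    ∑ (p ++ q) (termCoeff e)      ≈⟨ ∑-++ p q (termCoeff e) ⟩
    ∑ p (termCoeff e) + ∑ q (termCoeff e) ≡⟨ ≡.cong₂ _+_ (≡.sym (coeff≡∑ p e)) (≡.sym (coeff≡∑ q e)) ⟩
    coeff p e + coeff q e         ∎

  coeff-*P : ∀ {m} (p q : Pol m) e → coeff (p *P q) e ≈ ∑ p (λ t → ∑ q (λ u → termCoeff e (t · u)))
  coeff-*P p q e = trans (reflexive (coeff≡∑ (p *P q) e)) (∑-*P p q (termCoeff e))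

  termCoeff-cong : ∀ {m} e {a b} (d : Monomial m) → a ≈ b → termCoeff e (a , d) ≈ termCoeff e (b , d)
  termCoeff-cong e d a≈b with ⌊ ≡-dec ℕ._≟_ d e ⌋
  ... | true  = a≈b
  ... | false = refl

  termCoeff-neg : ∀ {m} e a (d : Monomial m) → termCoeff e (- a , d) ≈ - termCoeff e (a , d)
  termCoeff-neg e a d with ⌊ ≡-dec ℕ._≟_ d e ⌋
  ... | true  = refl
  ... | false = sym -0#≈0#

  -- The left-hand side is the coefficient of x^e in (a x^d) · q.
  ∑-shift : ∀ {m} (q : Pol m) e a d → d ≼ e → ∑ q (λ u → termCoeff e ((a , d) · u)) ≈ a * coeff q (e ⊖ d)
  ∑-shift []            e a d d≼e = sym (zeroʳ a)
  ∑-shift ((b , f) ∷ q) e a d d≼e =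
    trans (+-cong shifted (∑-shift q e a d d≼e)) (sym (distribˡ a _ _))
    where
    shifted : termCoeff e (a * b , d ⊕ f) ≈ a * termCoeff (e ⊖ d) (b , f)
    shifted with ≡-dec ℕ._≟_ (d ⊕ f) e | ≡-dec ℕ._≟_ f (e ⊖ d)
    ... | yes _      | yes _      = refl
    ... | no  _      | no  _      = sym (zeroʳ a)
    ... | yes d⊕f≡e  | no  f≢e⊖d  = ⊥-elim (f≢e⊖d (⊕≡⇒≡⊖ d f d⊕f≡e))
    ... | no  d⊕f≢e  | yes ≡.refl = ⊥-elim (d⊕f≢e (⊕-⊖-cancel d≼e))

  ∑-shift-∉ : ∀ {m} (q : Pol m) e a d → ¬ d ≼ e → ∑ q (λ u → termCoeff e ((a , d) · u)) ≈ 0#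
  ∑-shift-∉ q e a d d⋠e = ∑-zero q _ vanish
    where
    vanish : ∀ u → termCoeff e ((a , d) · u) ≈ 0#
    vanish (b , f) with ≡-dec ℕ._≟_ (d ⊕ f) e
    ... | yes d⊕f≡e = ⊥-elim (d⋠e (⊕≡⇒≼ d f d⊕f≡e))
    ... | no  _     = refl

  -- A record rather than _≃_ itself, so that Agda can infer the polynomials from an equation.
  infix 4 _≋_
  record _≋_ {m} (p q : Pol m) : Set ℓ where
    constructor mk≋
    field coeff-≈ : p ≃ q
  open _≋_ public

  ≋-refl : ∀ {m} {p : Pol m} → p ≋ p
  ≋-refl = mk≋ (λ e → refl)

  ≋-sym : ∀ {m} {p q : Pol m} → p ≋ q → q ≋ p
  ≋-sym (mk≋ p≃q) = mk≋ (λ e → sym (p≃q e))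

  ≋-trans : ∀ {m} {p q r : Pol m} → p ≋ q → q ≋ r → p ≋ r
  ≋-trans (mk≋ p≃q) (mk≋ q≃r) = mk≋ (λ e → trans (p≃q e) (q≃r e))

  ≋-reflexive : ∀ {m} {p q : Pol m} → p ≡ q → p ≋ q
  ≋-reflexive ≡.refl = ≋-refl

  ++-cong : ∀ {m} {p p′ q q′ : Pol m} → p ≋ p′ → q ≋ q′ → p ++ q ≋ p′ ++ q′
  ++-cong {p = p} {p′} {q} {q′} (mk≋ p≃p′) (mk≋ q≃q′) =
    mk≋ λ e → trans (coeff-++ p q e) (trans (+-cong (p≃p′ e) (q≃q′ e)) (sym (coeff-++ p′ q′ e)))

  ++-comm : ∀ {m} (p q : Pol m) → p ++ q ≋ q ++ p
  ++-comm p q = mk≋ λ e → trans (coeff-++ p q e) (trans (+-comm _ _) (sym (coeff-++ q p e)))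

  *P-comm : ∀ {m} (p q : Pol m) → p *P q ≋ q *P p
  *P-comm p q = mk≋ λ e → begin
    coeff (p *P q) e                                     ≈⟨ coeff-*P p q e ⟩
    ∑ p (λ t → ∑ q (λ u → termCoeff e (t · u)))          ≈⟨ ∑-swap p q _ ⟩
    ∑ q (λ u → ∑ p (λ t → termCoeff e (t · u)))          ≈⟨ ∑-cong q (λ u → ∑-cong p (λ t → ·-comm e t u)) ⟩
    ∑ q (λ u → ∑ p (λ t → termCoeff e (u · t)))          ≈⟨ coeff-*P q p e ⟨
    coeff (q *P p) e                                     ∎
    where
    ·-comm : ∀ e t u → termCoeff e (t · u) ≈ termCoeff e (u · t)
    ·-comm e (a , d) (b , f) =
      trans (reflexive (≡.cong (λ g → termCoeff e (a * b , g)) (⊕-comm d f))) (termCoeff-cong e (f ⊕ d) (*-comm a b))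

  *P-congˡ : ∀ {m} (p : Pol m) {q q′} → q ≋ q′ → p *P q ≋ p *P q′
  *P-congˡ p {q} {q′} (mk≋ q≃q′) = mk≋ λ e → begin
    coeff (p *P q) e                             ≈⟨ coeff-*P p q e ⟩
    ∑ p (λ t → ∑ q (λ u → termCoeff e (t · u)))  ≈⟨ ∑-cong p (inner e) ⟩
    ∑ p (λ t → ∑ q′ (λ u → termCoeff e (t · u))) ≈⟨ coeff-*P p q′ e ⟨
    coeff (p *P q′) e                            ∎
    where
    inner : ∀ e t → ∑ q (λ u → termCoeff e (t · u)) ≈ ∑ q′ (λ u → termCoeff e (t · u))
    inner e (a , d) with d ≼? e
    ... | yes d≼e = trans (∑-shift q e a d d≼e) (trans (*-congˡ (q≃q′ (e ⊖ d))) (sym (∑-shift q′ e a d d≼e)))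
    ... | no  d⋠e = trans (∑-shift-∉ q e a d d⋠e) (sym (∑-shift-∉ q′ e a d d⋠e))

  *P-cong : ∀ {m} {p p′ q q′ : Pol m} → p ≋ p′ → q ≋ q′ → p *P q ≋ p′ *P q′
  *P-cong {p = p} {p′} {q} {q′} p≋p′ q≋q′ =
    ≋-trans (*P-congˡ p q≋q′) (≋-trans (*P-comm p q′) (≋-trans (*P-congˡ q′ p≋p′) (*P-comm q′ p′)))

  *P-assoc : ∀ {m} (p q r : Pol m) → (p *P q) *P r ≋ p *P (q *P r)
  *P-assoc p q r = mk≋ λ e → begin
    coeff ((p *P q) *P r) e
      ≈⟨ coeff-*P (p *P q) r e ⟩
    ∑ (p *P q) (λ v → ∑ r (λ w → termCoeff e (v · w)))
      ≈⟨ ∑-*P p q _ ⟩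
    ∑ p (λ t → ∑ q (λ u → ∑ r (λ w → termCoeff e ((t · u) · w))))
      ≈⟨ ∑-cong p (λ t → ∑-cong q (λ u → ∑-cong r (λ w → ·-assoc e t u w))) ⟩
    ∑ p (λ t → ∑ q (λ u → ∑ r (λ w → termCoeff e (t · (u · w)))))
      ≈⟨ ∑-cong p (λ t → ∑-*P q r _) ⟨
    ∑ p (λ t → ∑ (q *P r) (λ v → termCoeff e (t · v)))
      ≈⟨ coeff-*P p (q *P r) e ⟨
    coeff (p *P (q *P r)) e
      ∎
    where
    ·-assoc : ∀ e t u w → termCoeff e ((t · u) · w) ≈ termCoeff e (t · (u · w))
    ·-assoc e (a , d) (b , f) (c′ , g) =
      trans (reflexive (≡.cong (λ h → termCoeff e ((a * b) * c′ , h)) (⊕-assoc d f g)))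
            (termCoeff-cong e (d ⊕ (f ⊕ g)) (*-assoc a b c′))

  *P-distribˡ : ∀ {m} (p q r : Pol m) → p *P (q ++ r) ≋ (p *P q) ++ (p *P r)
  *P-distribˡ p q r = mk≋ λ e → begin
    coeff (p *P (q ++ r)) e
      ≈⟨ coeff-*P p (q ++ r) e ⟩
    ∑ p (λ t → ∑ (q ++ r) (λ u → termCoeff e (t · u)))
      ≈⟨ ∑-cong p (λ t → ∑-++ q r _) ⟩
    ∑ p (λ t → ∑ q (λ u → termCoeff e (t · u)) + ∑ r (λ u → termCoeff e (t · u)))
      ≈⟨ ∑-+ p _ _ ⟩
    ∑ p (λ t → ∑ q (λ u → termCoeff e (t · u))) + ∑ p (λ t → ∑ r (λ u → termCoeff e (t · u)))
      ≈⟨ +-cong (coeff-*P p q e) (coeff-*P p r e) ⟨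
    coeff (p *P q) e + coeff (p *P r) e
      ≈⟨ coeff-++ (p *P q) (p *P r) e ⟨
    coeff ((p *P q) ++ (p *P r)) e
      ∎

  *P-distribʳ : ∀ {m} (p q r : Pol m) → (q ++ r) *P p ≋ (q *P p) ++ (r *P p)
  *P-distribʳ p q r =
    ≋-trans (*P-comm (q ++ r) p) (≋-trans (*P-distribˡ p q r) (++-cong (*P-comm p q) (*P-comm p r)))

  *P-identityˡ : ∀ {m} (p : Pol m) → 1P *P p ≋ p
  *P-identityˡ {m} p = mk≋ λ e → begin
    coeff (1P *P p) e                                      ≈⟨ coeff-*P 1P p e ⟩
    ∑ p (λ u → termCoeff e ((1# , replicate m 0) · u)) + 0# ≈⟨ +-identityʳ _ ⟩
    ∑ p (λ u → termCoeff e ((1# , replicate m 0) · u))      ≈⟨ ∑-cong p (unit e) ⟩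
    ∑ p (termCoeff e)                                      ≡⟨ coeff≡∑ p e ⟨
    coeff p e                                              ∎
    where
    unit : ∀ e u → termCoeff e ((1# , replicate m 0) · u) ≈ termCoeff e u
    unit e (b , f) =
      trans (reflexive (≡.cong (λ g → termCoeff e (1# * b , g)) (⊕-identityˡ f))) (termCoeff-cong e f (*-identityˡ b))

  -P_ : ∀ {m} → Pol m → Pol m
  -P p = map (λ { (a , d) → (- a , d) }) p

  coeff-neg : ∀ {m} (p : Pol m) e → coeff (-P p) e ≈ - coeff p e
  coeff-neg []            e = sym -0#≈0#
  coeff-neg ((a , d) ∷ p) e = trans (+-cong (termCoeff-neg e a d) (coeff-neg p e)) (-‿+-comm _ _)

  -P-cong : ∀ {m} {p q : Pol m} → p ≋ q → -P p ≋ -P q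
  -P-cong {p = p} {q} (mk≋ p≃q) = mk≋ λ e → trans (coeff-neg p e) (trans (-‿cong (p≃q e)) (sym (coeff-neg q e)))

  polynomialRing : ℕ → CommutativeRing c ℓ
  polynomialRing m = record
    { Carrier = Pol m
    ; _≈_ = _≋_
    ; _+_ = _++_
    ; _*_ = _*P_
    ; -_ = -P_
    ; 0# = []
    ; 1# = 1P
    ; isCommutativeRing = record
      { isRing = record
        { +-isAbelianGroup = record
          { isGroup = record
            { isMonoid = record
              { isSemigroup = record
                { isMagma = record
                  { isEquivalence = record { refl = ≋-refl ; sym = ≋-sym ; trans = ≋-trans }
                  ; ∙-cong = ++-cong }
                ; assoc = λ p q r → ≋-reflexive (Listₚ.++-assoc p q r) }
              ; identity = (λ p → ≋-refl) , (λ p → ≋-reflexive (Listₚ.++-identityʳ p)) }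
            ; inverse = (λ p → mk≋ λ e → trans (coeff-++ (-P p) p e) (trans (+-congʳ (coeff-neg p e)) (-‿inverseˡ _)))
                      , (λ p → mk≋ λ e → trans (coeff-++ p (-P p) e) (trans (+-congˡ (coeff-neg p e)) (-‿inverseʳ _)))
            ; ⁻¹-cong = -P-cong }
          ; comm = ++-comm }
        ; *-cong = *P-cong
        ; *-assoc = *P-assoc
        ; *-identity = *P-identityˡ , (λ p → ≋-trans (*P-comm p 1P) (*P-identityˡ p))
        ; distrib = *P-distribˡ , *P-distribʳ }
      ; *-comm = *P-comm } }

  mono-*P : ∀ {m} (d f : Monomial m) → mono d *P mono f ≋ mono (d ⊕ f)
  mono-*P d f = mk≋ λ e → +-congʳ (termCoeff-cong e (d ⊕ f) (*-identityˡ 1#))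

  coeff-mono : ∀ {m} (e : Monomial m) → coeff (mono e) e ≈ 1#
  coeff-mono e with ≡-dec ℕ._≟_ e e
  ... | yes _   = +-identityʳ 1#
  ... | no  e≢e = contradiction ≡.refl e≢e

  mono-^P : ∀ {m} (e : Monomial m) N → mono e ^P N ≋ mono (scaleExp N e)
  mono-^P e zero    = ≋-refl
  mono-^P e (suc N) = ≋-trans (*P-congˡ (mono e) (mono-^P e N)) (mono-*P e (scaleExp N e))

  module _ {m : ℕ} where
    open Ideals (polynomialRing m) using (IsIdeal; ∈-resp-≈; 0#∈; +-closed; *-closedˡ; √)
    open import Algebra.Properties.CommutativeSemiring.Exp (CommutativeRing.commutativeSemiring (polynomialRing m))
      using (_^_)

    combination : List (Pol m × Pol m) → Pol m
    combination hs = sumP (map (λ hg → proj₁ hg *P proj₂ hg) hs)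

    combination-++ : ∀ hs hs′ → combination (hs ++ hs′) ≡ combination hs ++ combination hs′
    combination-++ hs hs′ =
      ≡.trans (≡.cong sumP (Listₚ.map-++ _ hs hs′)) (≡.sym (Listₚ.concat-++ (map _ hs) (map _ hs′)))

    combination-*ˡ : ∀ z hs → z *P combination hs ≋ combination (map (λ hg → z *P proj₁ hg , proj₂ hg) hs)
    combination-*ˡ z []             = CommutativeRing.zeroʳ (polynomialRing m) z
    combination-*ˡ z ((h , g) ∷ hs) =
      ≋-trans (*P-distribˡ z (h *P g) (combination hs)) (++-cong (≋-sym (*P-assoc z h g)) (combination-*ˡ z hs))

    ⟨⟩-isIdeal : ∀ {ℓ′} (S : Pol m → Set ℓ′) → IsIdeal (_∈⟨ S ⟩)
    ⟨⟩-isIdeal S = record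
      { ∈-resp-≈  = λ { (mk≋ p≃q) (hs , hs∈S , p≃) → hs , hs∈S , λ e → trans (sym (p≃q e)) (p≃ e) }
      ; 0#∈       = [] , [] , λ e → refl
      ; +-closed  = λ { {p} {q} (hs , hs∈S , p≃) (hs′ , hs′∈S , q≃) →
                        hs ++ hs′ , Allₚ.++⁺ hs∈S hs′∈S ,
                        coeff-≈ (≋-trans (++-cong {p = p} {combination hs} {q} {combination hs′} (mk≋ p≃) (mk≋ q≃))
                                         (≋-reflexive (≡.sym (combination-++ hs hs′)))) }
      ; *-closedˡ = λ { z (hs , hs∈S , p≃) →
                        map (λ hg → z *P proj₁ hg , proj₂ hg) hs , Allₚ.map⁺ hs∈S ,
                        coeff-≈ (≋-trans (*P-congˡ z (mk≋ p≃)) (combination-*ˡ z hs)) }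
      }

    ∈⟨⟩-generator : ∀ {ℓ′} {S : Pol m → Set ℓ′} {g} → S g → g ∈⟨ S ⟩
    ∈⟨⟩-generator {g = g} g∈S =
      ((1P , g) ∷ []) , g∈S ∷ [] ,
      coeff-≈ (≋-sym (≋-trans (≋-reflexive (Listₚ.++-identityʳ (1P *P g))) (*P-identityˡ g)))

    ⟨⟩-least : ∀ {ℓ′ ι} {S : Pol m → Set ℓ′} {J : Pol m → Set ι} → IsIdeal J →
               (∀ {g} → S g → J g) → ∀ {f} → f ∈⟨ S ⟩ → J f
    ⟨⟩-least {S = S} {J} isJ S⊆J (hs , hs∈S , f≃) = ∈-resp-≈ isJ (≋-sym (mk≋ f≃)) (combination∈ hs hs∈S)
      where
      combination∈ : ∀ hs → All (λ hg → S (proj₂ hg)) hs → J (combination hs)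
      combination∈ []             []             = 0#∈ isJ
      combination∈ ((h , g) ∷ hs) (g∈S ∷ hs∈S) = +-closed isJ (*-closedˡ isJ h (S⊆J g∈S)) (combination∈ hs hs∈S)

    √⟨⟩⇒∈√⟨⟩ : ∀ {ℓ′} {S : Pol m → Set ℓ′} {f} → √ (_∈⟨ S ⟩) f → f ∈√⟨ S ⟩
    √⟨⟩⇒∈√⟨⟩ {S = S} {f} (N , f^N∈) = N , ≡.subst (_∈⟨ S ⟩) (^≡^P N) f^N∈
      where
      ^≡^P : ∀ N → f ^ N ≡ f ^P N
      ^≡^P zero    = ≡.refl
      ^≡^P (suc N) = ≡.cong (f *P_) (^≡^P N)

module Jets {c ℓ} (K : Field c ℓ) (n s : ℕ) where
  open Field K hiding (zero)
  open Poly K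
  open PolynomialRing K
  private
    ℙ : CommutativeRing c ℓ
    ℙ = polynomialRing (JVars n s)
    module ℙ = CommutativeRing ℙ
  open Sums ℙ using (Σ<; convolution; Σ<-cong; Σ<-head; Σ<-zero)
  open import Relation.Binary.Reasoning.Setoid ℙ.setoid

  infix 4 _≈S_
  _≈S_ : Series n s → Series n s → Set ℓ
  F ≈S G = ∀ j → at F j ≋ at G j

  ≈S-refl : ∀ {F : Series n s} → F ≈S F
  ≈S-refl j = ≋-refl

  ≈S-trans : ∀ {F G H : Series n s} → F ≈S G → G ≈S H → F ≈S H
  ≈S-trans F≈G G≈H j = ≋-trans (F≈G j) (G≈H j)

  sumP-applyUpTo : ∀ k (f : ℕ → ℕ) (T : ℕ → Pol (JVars n s)) → sumP (map T (applyUpTo f k)) ≋ Σ< k (T ∘ f)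
  sumP-applyUpTo zero    f T = ≋-refl
  sumP-applyUpTo (suc k) f T =
    ≋-trans (++-cong (≋-refl {p = T (f 0)}) (sumP-applyUpTo k (f ∘ suc) T)) (ℙ.sym (Σ<-head k (T ∘ f)))

  at-*S : ∀ (F G : Series n s) l → at (F *S G) l ≋ convolution (at F) (at G) l
  at-*S F G l = sumP-applyUpTo (suc l) id (λ p → at F p *P at G (l ∸ p))

  *S-cong : ∀ {F F′ G G′ : Series n s} → F ≈S F′ → G ≈S G′ → F *S G ≈S F′ *S G′
  *S-cong {F} {F′} {G} {G′} F≈F′ G≈G′ l = begin
    at (F *S G) l                    ≈⟨ at-*S F G l ⟩
    convolution (at F) (at G) l      ≈⟨ Σ<-cong (suc l) (λ p → *P-cong (F≈F′ p) (G≈G′ (l ∸ p))) ⟩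
    convolution (at F′) (at G′) l    ≈⟨ at-*S F′ G′ l ⟨
    at (F′ *S G′) l                  ∎

  constS-cong : ∀ {a b} → a ≈ b → constS {n} {s} a ≈S constS b
  constS-cong a≈b zero    = mk≋ λ e → +-congʳ (termCoeff-cong e _ a≈b)
  constS-cong a≈b (suc j) = ≋-refl

  at-constS-≢0 : ∀ a {j} → j ≢ 0 → at (constS {n} {s} a) j ≡ []
  at-constS-≢0 a {zero}  j≢0 = contradiction ≡.refl j≢0
  at-constS-≢0 a {suc j} j≢0 = ≡.refl

  1S : Series n s
  1S = constS 1#

  *S-identityˡ : ∀ (F : Series n s) → 1S *S F ≈S F
  *S-identityˡ F l = begin
    at (1S *S F) l
      ≈⟨ at-*S 1S F l ⟩
    convolution (at 1S) (at F) l
      ≈⟨ Σ<-head l _ ⟩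
    (1P *P at F l) ++ Σ< l (λ p → [] *P at F (l ∸ suc p))
      ≈⟨ ++-cong (*P-identityˡ (at F l)) (Σ<-zero l _ (λ p _ → ≋-refl)) ⟩
    at F l ++ []
      ≡⟨ Listₚ.++-identityʳ (at F l) ⟩
    at F l
      ∎

  *S-identityʳ : ∀ (F : Series n s) → F *S 1S ≈S F
  *S-identityʳ F l = begin
    at (F *S 1S) l
      ≈⟨ at-*S F 1S l ⟩
    Σ< l (λ p → at F p *P at 1S (l ∸ p)) ++ (at F l *P at 1S (l ∸ l))
      ≈⟨ ++-cong (Σ<-zero l _ earlier) last ⟩
    [] ++ at F l
      ∎
    where
    earlier : ∀ p → p < l → at F p *P at 1S (l ∸ p) ≋ []
    earlier p p<l rewrite at-constS-≢0 1# (ℕₚ.m>n⇒m∸n≢0 p<l) = ℙ.zeroʳ (at F p)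
    last : at F l *P at 1S (l ∸ l) ≋ at F l
    last rewrite ℕₚ.n∸n≡0 l = ℙ.*-identityʳ (at F l)

  +S-identityʳ : ∀ (F : Series n s) → F +S 0S ≈S F
  +S-identityʳ F j = ≋-reflexive (Listₚ.++-identityʳ (at F j))

  at-subst-toℕ : ∀ (x : Fin n) (k : Fin (suc s)) → at (subst s x) (toℕ k) ≡ jvar s x k
  at-subst-toℕ x k with toℕ k ℕ.<? suc s
  ... | yes k<1+s = ≡.cong (jvar s x) (Finₚ.fromℕ<-toℕ k k<1+s)
  ... | no  k≮1+s = contradiction (Finₚ.toℕ<n k) k≮1+s

  private
    factor : Fin n × ℕ → Series n s → Series n s
    factor (x , k) acc = powS (subst s x) k *S acc

    productOver : ∀ {k} → (Fin k → Fin n) → Vec ℕ k → Series n s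
    productOver g e = foldr factor 1S (toList (zip (tabulate g) e))

    productOver-0 : ∀ {k} (g : Fin k → Fin n) → productOver g (replicate k 0) ≈S 1S
    productOver-0 {zero}  g = ≈S-refl
    productOver-0 {suc k} g = ≈S-trans (*S-identityˡ _) (productOver-0 (g ∘ suc))

    productOver-unitExp : ∀ {k} (g : Fin k → Fin n) α → productOver g (unitExp α) ≈S subst s (g α)
    productOver-unitExp g zero    =
      ≈S-trans (*S-cong (*S-identityʳ (subst s (g zero))) (productOver-0 (g ∘ suc))) (*S-identityʳ _)
    productOver-unitExp g (suc α) = ≈S-trans (*S-identityˡ _) (productOver-unitExp (g ∘ suc) α)

    productOver-unitExp⊕unitExp : ∀ {k} (g : Fin k → Fin n) {α β} → α ≢ β →
      productOver g (unitExp α ⊕ unitExp β) ≈S subst s (g α) *S subst s (g β)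
      ⊎ productOver g (unitExp α ⊕ unitExp β) ≈S subst s (g β) *S subst s (g α)
    productOver-unitExp⊕unitExp g {zero}  {zero}  α≢β = contradiction ≡.refl α≢β
    productOver-unitExp⊕unitExp g {zero}  {suc β} α≢β rewrite ⊕-identityˡ (unitExp β) =
      inj₁ (*S-cong (*S-identityʳ (subst s (g zero))) (productOver-unitExp (g ∘ suc) β))
    productOver-unitExp⊕unitExp g {suc α} {zero}  α≢β rewrite ⊕-identityʳ (unitExp α) =
      inj₂ (*S-cong (*S-identityʳ (subst s (g zero))) (productOver-unitExp (g ∘ suc) α))
    productOver-unitExp⊕unitExp g {suc α} {suc β} α≢β =
      Sum.map (≈S-trans (*S-identityˡ _)) (≈S-trans (*S-identityˡ _))
        (productOver-unitExp⊕unitExp (g ∘ suc) (α≢β ∘ ≡.cong suc))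

  substMono-unitExp⊕unitExp : ∀ {x y : Fin n} → x ≢ y →
    substMono s (unitExp x ⊕ unitExp y) ≈S subst s x *S subst s y
    ⊎ substMono s (unitExp x ⊕ unitExp y) ≈S subst s y *S subst s x
  substMono-unitExp⊕unitExp = productOver-unitExp⊕unitExp id

  -- substMono multiplies the substituted variables in vertex order, hence the two cases.
  edge-generator : ∀ {x y : Fin n} → x ≢ y →
    (∀ l → at (substPol s (var x *P var y)) l ≋ convolution (at (subst s x)) (at (subst s y)) l)
    ⊎ (∀ l → at (substPol s (var x *P var y)) l ≋ convolution (at (subst s y)) (at (subst s x)) l)
  edge-generator {x} {y} x≢y = Sum.map (expand x y) (expand y x) (substMono-unitExp⊕unitExp x≢y)
    where
    substMono≈ : substPol s (var x *P var y) ≈S substMono s (unitExp x ⊕ unitExp y)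
    substMono≈ = ≈S-trans (+S-identityʳ _) (≈S-trans (*S-cong (constS-cong (*-identityˡ 1#)) ≈S-refl) (*S-identityˡ _))
    expand : ∀ z t → substMono s (unitExp x ⊕ unitExp y) ≈S subst s z *S subst s t →
             ∀ l → at (substPol s (var x *P var y)) l ≋ convolution (at (subst s z)) (at (subst s t)) l
    expand z t ≈zt l = ≋-trans (substMono≈ l) (≋-trans (≈zt l) (at-*S (subst s z) (subst s t) l))

module Vanishing {c ℓ} (K : Field c ℓ) (n s : ℕ) (u w : Fin (Poly.JVars K n s)) where
  open Field K hiding (zero)
  open Poly K
  open PolynomialRing K
  private
    ℙ : CommutativeRing c ℓ
    ℙ = polynomialRing (JVars n s)
    module ℙ = CommutativeRing ℙ
  open Sums ℙ using (convolution)
  open Ideals ℙ using (IsIdeal; ⊎-isIdeal; ∈-resp-≈; Σ<-closed)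
  open Jets K n s using (edge-generator)

  -- g lies in the ideal generated by the variables other than y_u and y_w,
  -- i.e. g becomes 0 when those variables are set to 0.
  Vanishes : Pol (JVars n s) → Set ℓ
  Vanishes g = ∀ e → SupportedOn u w e → coeff g e ≈ 0#

  vanishes-*P : ∀ h {g} → Vanishes g → Vanishes (h *P g)
  vanishes-*P h {g} g-vanishes e supp = trans (coeff-*P h g e) (∑-zero h _ term)
    where
    term : ∀ t → ∑ g (λ t′ → termCoeff e (t · t′)) ≈ 0#
    term (a , d) with d ≼? e
    ... | yes d≼e = trans (∑-shift g e a d d≼e)
                          (trans (*-congˡ (g-vanishes (e ⊖ d) (SupportedOn-⊖ {e = e} d supp))) (zeroʳ a))
    ... | no  d⋠e = ∑-shift-∉ g e a d d⋠e

  vanishes-isIdeal : IsIdeal Vanishes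
  vanishes-isIdeal = record
    { ∈-resp-≈  = λ { (mk≋ p≃q) p-vanishes e supp → trans (sym (p≃q e)) (p-vanishes e supp) }
    ; 0#∈       = λ e _ → refl
    ; +-closed  = λ { {p} {q} p-vanishes q-vanishes e supp →
                      trans (coeff-++ p q e) (trans (+-cong (p-vanishes e supp) (q-vanishes e supp)) (+-identityˡ 0#)) }
    ; *-closedˡ = vanishes-*P
    }

  InPair : Fin (JVars n s) → Set
  InPair x = x ≡ u ⊎ x ≡ w

  inPair? : ∀ x → Dec (InPair x)
  inPair? x = (x Finₚ.≟ u) ⊎-dec (x Finₚ.≟ w)

  var*var-vanishes : ∀ {α β} → ¬ (InPair α × InPair β) → Vanishes (var α *P var β)
  var*var-vanishes {α} {β} ∉pair e supp with ≡-dec ℕ._≟_ (unitExp α ⊕ unitExp β) e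
  ... | no  _      = +-identityˡ 0#
  ... | yes ≡.refl =
    contradiction (SupportedOn-unitExp⊕ α (unitExp β) supp , SupportedOn-unitExp⊕ β (unitExp α) supp′) ∉pair
    where
    supp′ : SupportedOn u w (unitExp β ⊕ unitExp α)
    supp′ = ≡.subst (SupportedOn u w) (⊕-comm (unitExp α) (unitExp β)) supp

  module _ (G : SimpleGraph n) where
    open SimpleGraph G using (Edge)

    EdgeHit : Set
    EdgeHit = ∃[ c ] ∃[ d ] ∃[ p ] ∃[ q ]
                (Edge c d × toℕ {suc s} p ℕ.+ toℕ {suc s} q ≤ s × InPair (combine c p) × InPair (combine d q))

    convolution-hits-or-vanishes : ∀ {c d} → Edge c d → ∀ l → l ≤ s →
      EdgeHit ⊎ Vanishes (convolution (at (subst s c)) (at (subst s d)) l)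
    convolution-hits-or-vanishes {c} {d} cd l l≤s =
      Σ<-closed (⊎-isIdeal EdgeHit vanishes-isIdeal) (suc l) _ term
      where
      term : ∀ p → p < suc l → EdgeHit ⊎ Vanishes (at (subst s c) p *P at (subst s d) (l ∸ p))
      term p p<1+l with p ℕ.<? suc s | (l ∸ p) ℕ.<? suc s
      ... | no  _  | _      = inj₂ (λ e _ → refl)
      ... | yes p< | no  _  =
        inj₂ (∈-resp-≈ vanishes-isIdeal (ℙ.sym (ℙ.zeroʳ (jvar s c (fromℕ< p<)))) (λ e _ → refl))
      ... | yes p< | yes q<
        with inPair? (combine c (fromℕ< p<)) ×-dec inPair? (combine d (fromℕ< q<))
      ...   | yes (α∈ , β∈) = inj₁ (c , d , fromℕ< p< , fromℕ< q< , cd , weight≤s , α∈ , β∈)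
        where
        weight≤s : toℕ (fromℕ< p<) ℕ.+ toℕ (fromℕ< q<) ≤ s
        weight≤s rewrite Finₚ.toℕ-fromℕ< p< | Finₚ.toℕ-fromℕ< q< | ℕₚ.m+[n∸m]≡n (ℕₚ.≤-pred p<1+l) = l≤s
      ...   | no  ∉pair     = inj₂ (var*var-vanishes ∉pair)

    generator-hits-or-vanishes : ∀ {g} → JetGens s (EdgeGens G) g → EdgeHit ⊎ Vanishes g
    generator-hits-or-vanishes (_ , (c , d , cd , ≡.refl) , l , l≤s , ≡.refl)
      with edge-generator (λ { ≡.refl → SimpleGraph.irreflex G cd })
    ... | inj₁ ≋conv = Sum.map₂ (∈-resp-≈ vanishes-isIdeal (≋-sym (≋conv l)))
                         (convolution-hits-or-vanishes cd l l≤s)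
    ... | inj₂ ≋conv = Sum.map₂ (∈-resp-≈ vanishes-isIdeal (≋-sym (≋conv l)))
                         (convolution-hits-or-vanishes (SimpleGraph.sym G cd) l l≤s)

    ∈√⇒edgeHit : ∀ {e} → SupportedOn u w e → mono e ∈√⟨ JetGens s (EdgeGens G) ⟩ → EdgeHit
    ∈√⇒edgeHit {e} supp (N , e^N∈)
      with ⟨⟩-least (⊎-isIdeal EdgeHit vanishes-isIdeal) generator-hits-or-vanishes {f = mono e ^P N} e^N∈
    ... | inj₁ hit       = hit
    ... | inj₂ vanishing = contradiction 1≈0 1≉0
      where
      1≈0 : 1# ≈ 0#
      1≈0 = trans (sym (coeff-mono (scaleExp N e)))
                  (∈-resp-≈ vanishes-isIdeal (mono-^P e N) vanishing (scaleExp N e) (SupportedOn-scaleExp N supp))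

open import Data.Nat using (_+_)

module JetGraph {c ℓ} (K : Field c ℓ) {n} (G : SimpleGraph n) (s : ℕ) where
  open Poly K using (Pol; JVars; mono; var; jvar; jmono2; _*P_; at; subst; substPol; _∈⟨_⟩; _∈√⟨_⟩; JetGens; EdgeGens)
  open PolynomialRing K
  open SimpleGraph G using (Edge; irreflex)
  open Jets K n s using (edge-generator; at-subst-toℕ)
  open Sums (polynomialRing (JVars n s)) using (convolution)
  open Ideals (polynomialRing (JVars n s)) using (∈-resp-≈; √; √-isIdeal; module Convolution)

  S : Pol (JVars n s) → Set c
  S = JetGens s (EdgeGens G)

  no-edgeHit-on-one-variable : ∀ x → ¬ Vanishing.EdgeHit K n s x x G
  no-edgeHit-on-one-variable x (c , d , p , q , cd , _ , c∈ , d∈) = irreflex (≡.subst (Edge c) (≡.sym c≡d) cd)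
    where
    c≡d : c ≡ d
    c≡d = Finₚ.combine-injectiveˡ c p d q (≡.trans (Sum.reduce c∈) (≡.sym (Sum.reduce d∈)))

  module _ {a b : Fin n} (a≢b : a ≢ b) (i j : Fin (suc s)) where
    private
      u w : Fin (JVars n s)
      u = combine a i
      w = combine b j

      u≢w : u ≢ w
      u≢w u≡w = a≢b (Finₚ.combine-injectiveˡ a i b j u≡w)

    edgeHit⇒edge : Vanishing.EdgeHit K n s u w G → Edge a b × toℕ i + toℕ j ≤ s
    edgeHit⇒edge (c , d , p , q , cd , p+q≤s , c∈ , d∈) with c∈ | d∈
    ... | inj₁ cp≡u | inj₁ dq≡u
      with ≡.refl , _ ← Finₚ.combine-injective c p a i cp≡u | ≡.refl , _ ← Finₚ.combine-injective d q a i dq≡u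
      = contradiction cd irreflex
    ... | inj₁ cp≡u | inj₂ dq≡w
      with ≡.refl , ≡.refl ← Finₚ.combine-injective c p a i cp≡u | ≡.refl , ≡.refl ← Finₚ.combine-injective d q b j dq≡w
      = cd , p+q≤s
    ... | inj₂ cp≡w | inj₁ dq≡u
      with ≡.refl , ≡.refl ← Finₚ.combine-injective c p b j cp≡w | ≡.refl , ≡.refl ← Finₚ.combine-injective d q a i dq≡u
      = SimpleGraph.sym G cd , ≡.subst (_≤ s) (ℕₚ.+-comm (toℕ j) (toℕ i)) p+q≤s
    ... | inj₂ cp≡w | inj₂ dq≡w
      with ≡.refl , _ ← Finₚ.combine-injective c p b j cp≡w | ≡.refl , _ ← Finₚ.combine-injective d q b j dq≡w
      = contradiction cd irreflex

    jetMonomial∈√⇒edge : mono (jmono2 s (a , i) (b , j)) ∈√⟨ S ⟩ → Edge a b × toℕ i + toℕ j ≤ s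
    jetMonomial∈√⇒edge = edgeHit⇒edge ∘ Vanishing.∈√⇒edgeHit K n s u w G (pairExp-supported u w)

    jetGenerator∈ : Edge a b → ∀ l → l ≤ s → at (substPol s (var a *P var b)) l ∈⟨ S ⟩
    jetGenerator∈ ab l l≤s = ∈⟨⟩-generator (var a *P var b , (a , b , ab , ≡.refl) , l , l≤s , ≡.refl)

    convolution-terms∈√ : Edge a b → ∀ {x y} →
      (∀ l → at (substPol s (var a *P var b)) l ≋ convolution (at (subst s x)) (at (subst s y)) l) →
      ∀ p q → toℕ p + toℕ q ≤ s → √ (_∈⟨ S ⟩) (jvar s x p *P jvar s y q)
    convolution-terms∈√ ab {x} {y} ≋conv p q p+q≤s =
      ≡.subst₂ (λ f g → √ (_∈⟨ S ⟩) (f *P g)) (at-subst-toℕ x p) (at-subst-toℕ y q)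
        (Convolution.terms∈√ (⟨⟩-isIdeal S) (at (subst s x)) (at (subst s y)) s
           (λ l l≤s → ∈-resp-≈ (⟨⟩-isIdeal S) (≋conv l) (jetGenerator∈ ab l l≤s)) (toℕ p) (toℕ q) p+q≤s)

    jvar*jvar∈√ : Edge a b → toℕ i + toℕ j ≤ s → √ (_∈⟨ S ⟩) (jvar s a i *P jvar s b j)
    jvar*jvar∈√ ab i+j≤s with edge-generator a≢b
    ... | inj₁ ≋conv = convolution-terms∈√ ab ≋conv i j i+j≤s
    ... | inj₂ ≋conv = ∈-resp-≈ (√-isIdeal (⟨⟩-isIdeal S)) (*P-comm (jvar s b j) (jvar s a i))
                         (convolution-terms∈√ ab ≋conv j i (≡.subst (_≤ s) (ℕₚ.+-comm (toℕ i) (toℕ j)) i+j≤s))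

    edge⇒jetMonomial∈√ : Edge a b → toℕ i + toℕ j ≤ s → mono (jmono2 s (a , i) (b , j)) ∈√⟨ S ⟩
    edge⇒jetMonomial∈√ ab i+j≤s =
      √⟨⟩⇒∈√⟨⟩ (∈-resp-≈ (√-isIdeal (⟨⟩-isIdeal S)) jvar*jvar≋mono (jvar*jvar∈√ ab i+j≤s))
      where
      jvar*jvar≋mono : jvar s a i *P jvar s b j ≋ mono (pairExp u w)
      jvar*jvar≋mono = ≋-trans (mono-*P (unitExp u) (unitExp w))
                               (≋-reflexive (≡.cong mono (≡.sym (pairExp≡unitExp⊕unitExp u w))))

    jetMonomial-minimal : ∀ e → e ≼ jmono2 s (a , i) (b , j) → e ≢ jmono2 s (a , i) (b , j) →
                          ¬ mono e ∈√⟨ S ⟩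
    jetMonomial-minimal e e≼ e≢ e∈√ with ≼-pairExp u≢w e≼
    ... | inj₁ supp        = no-edgeHit-on-one-variable u (Vanishing.∈√⇒edgeHit K n s u u G supp e∈√)
    ... | inj₂ (inj₁ supp) = no-edgeHit-on-one-variable w (Vanishing.∈√⇒edgeHit K n s w w G supp e∈√)
    ... | inj₂ (inj₂ e≡)   = e≢ e≡

lemma1 : ∀ {c ℓ} (K : Field c ℓ) (n : ℕ) (G : SimpleGraph n) (a b : Fin n) → a ≢ b →
           (s : ℕ) (i j : Fin (suc s)) →
           Poly.JetEdge K G s (a , i) (b , j) ⇔ (SimpleGraph.Edge G a b × toℕ i + toℕ j ≤ s)
lemma1 K n G a b a≢b s i j = mk⇔
  (λ { (_ , jetMonomial∈√ , _) → jetMonomial∈√⇒edge a≢b i j jetMonomial∈√ })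
  (λ { (ab , i+j≤s) → (λ ai≡bj → a≢b (≡.cong proj₁ ai≡bj))
                    , edge⇒jetMonomial∈√ a≢b i j ab i+j≤s
                    , jetMonomial-minimal a≢b i j })
  where open JetGraph K G s
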